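{- An s$\ell$-monoid $N$ is integral if and only if $N$ is isomorphic (as an s$\ell$-monoid) to the nuclear image $M_\gamma$ of some integral cancellative s$\ell$-monoid $M$ with respect to some nucleus $\gamma$ on $M$.
   Context: An s$\ell$-monoid is a structure $\langle M,\vee,\cdot,1\rangle$ where $\langle M,\vee\rangle$ is a join semilattice, $\langle M,\cdot,1\rangle$ is a monoid, and multiplication distributes over binary joins on both sides; it is ordered by its semilattice order. It is integral if $1$ is the top element, and cancellative if $ax\leq bx$ implies $a\leq b$ and $xa\leq xb$ implies $a\leq b$. A nucleus on $M$ is a monotone map $\gamma$ with $a\leq\gamma(a)=\gamma(\gamma(a))$ and $\gamma(a)\gamma(b)\leq\gamma(ab)$; the nuclear image $M_\gamma=\{a:\gamma(a)=a\}$ is an s$\ell$-monoid with inherited order, joins $\gamma(a\vee b)$, multiplication $\gamma(ab)$, unit $\gamma(1)$. -}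

module Defs where

open import Level using (Level; _⊔_; suc)
open import Data.Product using (Σ; _×_; _,_; proj₁; proj₂; ∃)
open import Relation.Binary.Structures using (IsEquivalence)

record RawSLMonoid (c ℓ : Level) : Set (suc (c ⊔ ℓ)) where
  infixl 6 _∨_
  infixl 7 _·_
  infix 4 _≈_ _≤_
  field
    Carrier : Set c
    _≈_     : Carrier → Carrier → Set ℓ
    _∨_     : Carrier → Carrier → Carrier
    _·_     : Carrier → Carrier → Carrier
    one     : Carrier

  _≤_ : Carrier → Carrier → Set ℓ
  a ≤ b = (a ∨ b) ≈ b

record IsSLMonoid {c ℓ} (R : RawSLMonoid c ℓ) : Set (c ⊔ ℓ) where
  open RawSLMonoid R
  field
    isEquivalence : IsEquivalence _≈_
    ∨-cong   : ∀ {a a' b b'} → a ≈ a' → b ≈ b' → (a ∨ b) ≈ (a' ∨ b')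
    ·-cong   : ∀ {a a' b b'} → a ≈ a' → b ≈ b' → (a · b) ≈ (a' · b')
    ∨-assoc  : ∀ a b d → ((a ∨ b) ∨ d) ≈ (a ∨ (b ∨ d))
    ∨-comm   : ∀ a b → (a ∨ b) ≈ (b ∨ a)
    ∨-idem   : ∀ a → (a ∨ a) ≈ a
    ·-assoc  : ∀ a b d → ((a · b) · d) ≈ (a · (b · d))
    ·-identityˡ : ∀ a → (one · a) ≈ a
    ·-identityʳ : ∀ a → (a · one) ≈ a
    ·-distribˡ-∨ : ∀ a b d → (a · (b ∨ d)) ≈ ((a · b) ∨ (a · d))
    ·-distribʳ-∨ : ∀ a b d → ((b ∨ d) · a) ≈ ((b · a) ∨ (d · a))

record SLMonoid (c ℓ : Level) : Set (suc (c ⊔ ℓ)) where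
  field
    raw        : RawSLMonoid c ℓ
    isSLMonoid : IsSLMonoid raw
  open RawSLMonoid raw public
  open IsSLMonoid isSLMonoid public

IsIntegral : ∀ {c ℓ} → SLMonoid c ℓ → Set (c ⊔ ℓ)
IsIntegral M = ∀ a → a ≤ one
  where open SLMonoid M

IsCancellative : ∀ {c ℓ} → SLMonoid c ℓ → Set (c ⊔ ℓ)
IsCancellative M =
  (∀ a b x → (a · x) ≤ (b · x) → a ≤ b) ×
  (∀ a b x → (x · a) ≤ (x · b) → a ≤ b)
  where open SLMonoid M

record IsNucleus {c ℓ} (M : SLMonoid c ℓ)
                 (γ : SLMonoid.Carrier M → SLMonoid.Carrier M) : Set (c ⊔ ℓ) where
  open SLMonoid M
  field
    monotone    : ∀ {a b} → a ≤ b → γ a ≤ γ b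
    extensive   : ∀ a → a ≤ γ a
    idempotent  : ∀ a → γ (γ a) ≈ γ a
    submultiplicative : ∀ a b → (γ a · γ b) ≤ γ (a · b)

nuclearImage : ∀ {c ℓ} (M : SLMonoid c ℓ)
               (γ : SLMonoid.Carrier M → SLMonoid.Carrier M) →
               IsNucleus M γ → RawSLMonoid (c ⊔ ℓ) ℓ
nuclearImage M γ nuc = record
  { Carrier = Σ Carrier (λ a → γ a ≈ a)
  ; _≈_     = λ x y → proj₁ x ≈ proj₁ y
  ; _∨_     = λ x y → γ (proj₁ x ∨ proj₁ y) , idempotent (proj₁ x ∨ proj₁ y)
  ; _·_     = λ x y → γ (proj₁ x · proj₁ y) , idempotent (proj₁ x · proj₁ y)
  ; one     = γ one , idempotent one
  }
  where
  open SLMonoid M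
  open IsNucleus nuc

record IsIsomorphism {c₁ ℓ₁ c₂ ℓ₂}
         (A : RawSLMonoid c₁ ℓ₁) (B : RawSLMonoid c₂ ℓ₂)
         (f : RawSLMonoid.Carrier A → RawSLMonoid.Carrier B)
         : Set (c₁ ⊔ ℓ₁ ⊔ c₂ ⊔ ℓ₂) where
  private
    module A = RawSLMonoid A
    module B = RawSLMonoid B
  field
    cong        : ∀ {a b} → a A.≈ b → f a B.≈ f b
    injective   : ∀ {a b} → f a B.≈ f b → a A.≈ b
    surjective  : ∀ y → ∃ λ x → f x B.≈ y
    ∨-homo      : ∀ a b → f (a A.∨ b) B.≈ (f a B.∨ f b)
    ·-homo      : ∀ a b → f (a A.· b) B.≈ (f a B.· f b)
    one-homo    : f A.one B.≈ B.one

_≅_ : ∀ {c₁ ℓ₁ c₂ ℓ₂} → RawSLMonoid c₁ ℓ₁ → RawSLMonoid c₂ ℓ₂ →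
      Set (c₁ ⊔ ℓ₁ ⊔ c₂ ⊔ ℓ₂)
A ≅ B = ∃ λ f → IsIsomorphism A B f

-- Given an integral N, let M consist of the finitely generated down-sets of
-- the free monoid of words over N, where a word w lies below h = h₁ … hₖ
-- when w can be cut into consecutive blocks whose products lie below
-- h₁, …, hₖ, followed by an arbitrary remainder (harmless since N is
-- integral).  Joins are unions and products are pointwise concatenations, so
-- M is integral, and it is cancellative because a cover of x w by y z either
-- already covers x by y, or covers a strictly shorter suffix of w by z.  The
-- nucleus collapses a down-set to the one-letter word given by the join of
-- its evaluations, and the one-letter words form a copy of N.  Conversely,
-- every nuclear image of an integral sℓ-monoid is integral.
module Submission where

open import Defs
open import Level using (_⊔_)
open import Data.Product using (Σ; ∃; ∃₂; _×_; _,_; proj₁)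
open import Data.Sum using (_⊎_; inj₁; inj₂)
open import Data.Unit.Polymorphic using (⊤; tt)
open import Data.Empty.Polymorphic using (⊥)
open import Data.Nat using (ℕ; zero; suc; _+_; _<_; z≤n; s≤s)
import Data.Nat.Properties as ℕ
open import Data.Nat.Induction using (<-wellFounded)
open import Data.List
  using (List; []; _∷_; _++_; [_]; map; take; drop; length; cartesianProductWith)
open import Data.List.Properties
  using (++-assoc; ++-identityʳ; take++drop≡id; take-take; take-drop; drop-drop; take-all;
         length-drop; cartesianProductWith-distribʳ-++)
open import Data.List.NonEmpty using (List⁺; _∷_; _⁺++⁺_; toList)
open import Function using (id)
open import Function.Bundles using (_⇔_; mk⇔)
open import Induction.WellFounded using (Acc; acc)
open import Relation.Binary.Bundles using (Setoid; Poset)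
open import Relation.Binary.Structures using (IsEquivalence)
open import Relation.Binary.PropositionalEquality using (_≡_; refl; sym; trans; cong; subst)
import Relation.Binary.Reasoning.Setoid as SetoidReasoning
import Relation.Binary.Reasoning.PartialOrder as PosetReasoning

module _ {a} {A : Set a} where

  take-drop-++ : ∀ i (xs ys : List A) →
                 ∃ λ j → take j (xs ++ ys) ≡ take i xs × drop j (xs ++ ys) ≡ drop i xs ++ ys
  take-drop-++ zero    xs       ys = zero , refl , refl
  take-drop-++ (suc i) []       ys = zero , refl , refl
  take-drop-++ (suc i) (x ∷ xs) ys with take-drop-++ i xs ys
  ... | j , t , d = suc j , cong (x ∷_) t , d

  take-take-+ : ∀ i j (xs : List A) → take i (take (i + j) xs) ≡ take i xs
  take-take-+ i j xs =
    trans (take-take i (i + j) xs) (cong (λ k → take k xs) (ℕ.m≤n⇒m⊓n≡m (ℕ.m≤m+n i j)))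

  take-++-or-drop-shorter : ∀ j (xs ys : List A) →
    take j (xs ++ ys) ≡ take j xs ⊎ length (drop j (xs ++ ys)) < length ys
  take-++-or-drop-shorter zero    xs       ys       = inj₁ refl
  take-++-or-drop-shorter (suc j) []       []       = inj₁ refl
  take-++-or-drop-shorter (suc j) []       (y ∷ ys) =
    inj₂ (s≤s (ℕ.≤-trans (ℕ.≤-reflexive (length-drop j ys)) (ℕ.m∸n≤m (length ys) j)))
  take-++-or-drop-shorter (suc j) (x ∷ xs) ys with take-++-or-drop-shorter j xs ys
  ... | inj₁ e     = inj₁ (cong (x ∷_) e)
  ... | inj₂ short = inj₂ short

  drop-++-or-take-shorter : ∀ j (xs ys : List A) →
    (∃ λ k → drop j (xs ++ ys) ≡ drop k ys) ⊎ length (take j (xs ++ ys)) < length xs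
  drop-++-or-take-shorter j       []       ys = inj₁ (j , refl)
  drop-++-or-take-shorter zero    (x ∷ xs) ys = inj₂ (s≤s z≤n)
  drop-++-or-take-shorter (suc j) (x ∷ xs) ys with drop-++-or-take-shorter j xs ys
  ... | inj₁ e     = inj₁ e
  ... | inj₂ short = inj₂ (s≤s short)

module SLMonoidOrder {c ℓ} (S : SLMonoid c ℓ) where
  open SLMonoid S

  open IsEquivalence isEquivalence public
    using () renaming (refl to ≈-refl; sym to ≈-sym; trans to ≈-trans)

  setoid : Setoid c ℓ
  setoid = record { Carrier = Carrier ; _≈_ = _≈_ ; isEquivalence = isEquivalence }

  open SetoidReasoning setoid

  ≤-reflexive : ∀ {a b} → a ≈ b → a ≤ b
  ≤-reflexive {a} {b} a≈b = ≈-trans (∨-cong a≈b ≈-refl) (∨-idem b)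

  ≤-trans : ∀ {a b d} → a ≤ b → b ≤ d → a ≤ d
  ≤-trans {a} {b} {d} a≤b b≤d = begin
    a ∨ d       ≈⟨ ∨-cong ≈-refl (≈-sym b≤d) ⟩
    a ∨ (b ∨ d) ≈⟨ ≈-sym (∨-assoc a b d) ⟩
    (a ∨ b) ∨ d ≈⟨ ∨-cong a≤b ≈-refl ⟩
    b ∨ d       ≈⟨ b≤d ⟩
    d           ∎

  ≤-antisym : ∀ {a b} → a ≤ b → b ≤ a → a ≈ b
  ≤-antisym {a} {b} a≤b b≤a = ≈-trans (≈-sym b≤a) (≈-trans (∨-comm b a) a≤b)

  poset : Poset c ℓ ℓ
  poset = record
    { Carrier = Carrier ; _≈_ = _≈_ ; _≤_ = _≤_
    ; isPartialOrder = record
      { isPreorder = record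
        { isEquivalence = isEquivalence ; reflexive = ≤-reflexive ; trans = ≤-trans }
      ; antisym = ≤-antisym } }

  x≤x∨y : ∀ a b → a ≤ a ∨ b
  x≤x∨y a b = ≈-trans (≈-sym (∨-assoc a a b)) (∨-cong (∨-idem a) ≈-refl)

  y≤x∨y : ∀ a b → b ≤ a ∨ b
  y≤x∨y a b = ≤-trans (x≤x∨y b a) (≤-reflexive (∨-comm b a))

  ∨-least : ∀ {a b d} → a ≤ d → b ≤ d → a ∨ b ≤ d
  ∨-least {a} {b} {d} a≤d b≤d = ≈-trans (∨-assoc a b d) (≈-trans (∨-cong ≈-refl b≤d) a≤d)

  ·-monoˡ : ∀ {a a'} b → a ≤ a' → a · b ≤ a' · b
  ·-monoˡ {a} {a'} b a≤a' = ≈-trans (≈-sym (·-distribʳ-∨ b a a')) (·-cong a≤a' ≈-refl)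

  ·-monoʳ : ∀ a {b b'} → b ≤ b' → a · b ≤ a · b'
  ·-monoʳ a {b} {b'} b≤b' = ≈-trans (≈-sym (·-distribˡ-∨ a b b')) (·-cong ≈-refl b≤b')

  ·-mono : ∀ {a a' b b'} → a ≤ a' → b ≤ b' → a · b ≤ a' · b'
  ·-mono {a' = a'} {b} a≤a' b≤b' = ≤-trans (·-monoˡ b a≤a') (·-monoʳ a' b≤b')

  x·y≤y : IsIntegral S → ∀ a b → a · b ≤ b
  x·y≤y integral a b = ≤-trans (·-monoˡ b (integral a)) (≤-reflexive (·-identityˡ b))

module NuclearImage {c ℓ} (M : SLMonoid c ℓ) {γ : SLMonoid.Carrier M → SLMonoid.Carrier M}
                    (nucleus : IsNucleus M γ) where
  open SLMonoid M
  open IsNucleus nucleus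
  open SLMonoidOrder M
  private module Mγ = RawSLMonoid (nuclearImage M γ nucleus)

  γ-cong : ∀ {a b} → a ≈ b → γ a ≈ γ b
  γ-cong a≈b = ≤-antisym (monotone (≤-reflexive a≈b)) (monotone (≤-reflexive (≈-sym a≈b)))

  nuclearImage-integral : IsIntegral M → ∀ x → x Mγ.≤ Mγ.one
  nuclearImage-integral integral (a , _) =
    ≈-trans (γ-cong (≤-trans (integral a) (extensive one))) (idempotent one)

  integral-if-≅-nuclearImage : ∀ {c' ℓ'} (N : SLMonoid c' ℓ') → IsIntegral M →
                               SLMonoid.raw N ≅ nuclearImage M γ nucleus → IsIntegral N
  integral-if-≅-nuclearImage N integral (f , iso) a = injective (begin
    proj₁ (f (a N.∨ N.one))           ≈⟨ ∨-homo a N.one ⟩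
    γ (proj₁ (f a) ∨ proj₁ (f N.one)) ≈⟨ γ-cong (∨-cong ≈-refl one-homo) ⟩
    γ (proj₁ (f a) ∨ γ one)           ≈⟨ nuclearImage-integral integral (f a) ⟩
    γ one                             ≈⟨ ≈-sym one-homo ⟩
    proj₁ (f N.one)                   ∎)
    where
    module N = SLMonoid N
    open IsIsomorphism iso
    open SetoidReasoning setoid

module CoverMonoid {c ℓ} (N : SLMonoid c ℓ) (integral : IsIntegral N) where
  open SLMonoid N
  open SLMonoidOrder N

  Word : Set c
  Word = List Carrier

  ev : Word → Carrier
  ev []      = one
  ev (a ∷ w) = a · ev w

  ev-++ : ∀ u v → ev (u ++ v) ≈ ev u · ev v
  ev-++ []      v = ≈-sym (·-identityˡ (ev v))
  ev-++ (a ∷ u) v = ≈-trans (·-cong ≈-refl (ev-++ u v)) (≈-sym (·-assoc a (ev u) (ev v)))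

  infix 4 _≼_ _∈↓_ _⊆↓_ _⊑_

  _≼_ : Word → Word → Set ℓ
  w ≼ []    = ⊤
  w ≼ a ∷ h = Σ ℕ λ i → ev (take i w) ≤ a × drop i w ≼ h

  ≼-at : ∀ i {w u v a h} → take i w ≡ u → drop i w ≡ v → ev u ≤ a → v ≼ h → w ≼ a ∷ h
  ≼-at i refl refl u≤a v≼h = i , u≤a , v≼h

  ≼⇒ev≤ : ∀ {w} h → w ≼ h → ev w ≤ ev h
  ≼⇒ev≤ {w} []      _             = integral (ev w)
  ≼⇒ev≤ {w} (a ∷ h) (i , u≤a , v≼h) = begin
    ev w                            ≡⟨ cong ev (sym (take++drop≡id i w)) ⟩
    ev (take i w ++ drop i w)       ≈⟨ ev-++ (take i w) (drop i w) ⟩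
    ev (take i w) · ev (drop i w)   ≤⟨ ·-mono u≤a (≼⇒ev≤ h v≼h) ⟩
    a · ev h                        ∎
    where open PosetReasoning poset

  ≼-refl : ∀ w → w ≼ w
  ≼-refl []      = tt
  ≼-refl (a ∷ w) = 1 , ≤-reflexive (·-identityʳ a) , ≼-refl w

  ≼-∷ : ∀ a {w} h → w ≼ h → a ∷ w ≼ h
  ≼-∷ a []      _               = tt
  ≼-∷ a (b ∷ h) (i , u≤b , v≼h) = suc i , ≤-trans (x·y≤y integral a _) u≤b , v≼h

  ≼-++ˡ : ∀ u {w} h → w ≼ h → u ++ w ≼ h
  ≼-++ˡ []      h w≼h = w≼h
  ≼-++ˡ (a ∷ u) h w≼h = ≼-∷ a h (≼-++ˡ u h w≼h)

  ≼-++ : ∀ {u u'} h {h'} → u ≼ h → u' ≼ h' → u ++ u' ≼ h ++ h'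
  ≼-++ {u} []      _                 u'≼h' = ≼-++ˡ u _ u'≼h'
  ≼-++ {u} {u'} (a ∷ h) (i , t≤a , d≼h) u'≼h' with take-drop-++ i u u'
  ... | j , t , d = ≼-at j t d t≤a (≼-++ h d≼h u'≼h')

  ≼-++ʳ : ∀ {w} v h → w ≼ h → w ++ v ≼ h
  ≼-++ʳ v h w≼h = subst (_ ≼_) (++-identityʳ h) (≼-++ h w≼h tt)

  ≼-take : ∀ i {w} h → take i w ≼ h → w ≼ h
  ≼-take i {w} h t≼h = subst (_≼ h) (take++drop≡id i w) (≼-++ʳ (drop i w) h t≼h)

  ≼-drop : ∀ i {w} h → drop i w ≼ h → w ≼ h
  ≼-drop i {w} h d≼h = subst (_≼ h) (take++drop≡id i w) (≼-++ˡ (take i w) h d≼h)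

  ≼-split : ∀ {w} h₁ h₂ → w ≼ h₁ ++ h₂ → ∃ λ j → take j w ≼ h₁ × drop j w ≼ h₂
  ≼-split []       h₂ w≼h₂ = 0 , tt , w≼h₂
  ≼-split {w} (a ∷ h₁) h₂ (i , t≤a , d≼h) with ≼-split h₁ h₂ d≼h
  ... | j , p₁ , p₂ =
    i + j , ≼-at i (take-take-+ i j w) (sym (take-drop j i w)) t≤a p₁ ,
    subst (_≼ h₂) (drop-drop i j w) p₂

  ≼-trans : ∀ {u} v w → u ≼ v → v ≼ w → u ≼ w
  ≼-trans v []      _   _               = tt
  ≼-trans v (a ∷ w) u≼v (i , t≤a , d≼w)
    with ≼-split (take i v) (drop i v) (subst (_ ≼_) (sym (take++drop≡id i v)) u≼v)
  ... | j , p₁ , p₂ = j , ≤-trans (≼⇒ev≤ (take i v) p₁) t≤a , ≼-trans (drop i v) w p₂ d≼w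

  ≼-singleton⁺ : ∀ {w a} → ev w ≤ a → w ≼ [ a ]
  ≼-singleton⁺ {w} {a} w≤a =
    length w , subst (λ u → ev u ≤ a) (sym (take-all (length w) w ℕ.≤-refl)) w≤a , tt

  ≼-singleton⁻ : ∀ {w a} → w ≼ [ a ] → ev w ≤ a
  ≼-singleton⁻ {a = a} w≼a = ≤-trans (≼⇒ev≤ [ a ] w≼a) (≤-reflexive (·-identityʳ a))

  _∈↓_ : Word → List Word → Set ℓ
  w ∈↓ []    = ⊥
  w ∈↓ h ∷ X = w ≼ h ⊎ w ∈↓ X

  _⊆↓_ : List Word → List Word → Set (c ⊔ ℓ)
  X ⊆↓ Y = ∀ {w} → w ∈↓ X → w ∈↓ Y

  -- A form of _⊆↓_ that does not quantify over words, so that it lives in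
  -- Set ℓ, as the equality of an sℓ-monoid must.
  _⊑_ : List Word → List Word → Set ℓ
  []    ⊑ Y = ⊤
  g ∷ X ⊑ Y = g ∈↓ Y × X ⊑ Y

  ∈↓-≼ : ∀ {u w} X → u ≼ w → w ∈↓ X → u ∈↓ X
  ∈↓-≼ (h ∷ X) u≼w (inj₁ w≼h) = inj₁ (≼-trans _ h u≼w w≼h)
  ∈↓-≼ (h ∷ X) u≼w (inj₂ w∈X) = inj₂ (∈↓-≼ X u≼w w∈X)

  ⊑⇒⊆↓ : ∀ X {Y} → X ⊑ Y → X ⊆↓ Y
  ⊑⇒⊆↓ (g ∷ X) {Y} (g∈Y , _) (inj₁ w≼g) = ∈↓-≼ Y w≼g g∈Y
  ⊑⇒⊆↓ (g ∷ X)     (_ , X⊑Y) (inj₂ w∈X) = ⊑⇒⊆↓ X X⊑Y w∈X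

  ⊆↓⇒⊑ : ∀ X {Y} → X ⊆↓ Y → X ⊑ Y
  ⊆↓⇒⊑ []      _   = tt
  ⊆↓⇒⊑ (g ∷ X) X⊆Y = X⊆Y (inj₁ (≼-refl g)) , ⊆↓⇒⊑ X (λ w∈X → X⊆Y (inj₂ w∈X))

  ∈↓-++⁺ˡ : ∀ X {Y w} → w ∈↓ X → w ∈↓ X ++ Y
  ∈↓-++⁺ˡ (h ∷ X) (inj₁ w≼h) = inj₁ w≼h
  ∈↓-++⁺ˡ (h ∷ X) (inj₂ w∈X) = inj₂ (∈↓-++⁺ˡ X w∈X)

  ∈↓-++⁺ʳ : ∀ X {Y w} → w ∈↓ Y → w ∈↓ X ++ Y
  ∈↓-++⁺ʳ []      w∈Y = w∈Y
  ∈↓-++⁺ʳ (h ∷ X) w∈Y = inj₂ (∈↓-++⁺ʳ X w∈Y)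

  ∈↓-++⁻ : ∀ X {Y w} → w ∈↓ X ++ Y → w ∈↓ X ⊎ w ∈↓ Y
  ∈↓-++⁻ []      w∈Y          = inj₂ w∈Y
  ∈↓-++⁻ (h ∷ X) (inj₁ w≼h)   = inj₁ (inj₁ w≼h)
  ∈↓-++⁻ (h ∷ X) (inj₂ w∈XY) with ∈↓-++⁻ X w∈XY
  ... | inj₁ w∈X = inj₁ (inj₂ w∈X)
  ... | inj₂ w∈Y = inj₂ w∈Y

  infixl 7 _⊗_
  _⊗_ : List Word → List Word → List Word
  _⊗_ = cartesianProductWith _++_

  ∈↓-⊗⁺ : ∀ X Y {g h} → g ∈↓ X → h ∈↓ Y → g ++ h ∈↓ X ⊗ Y
  ∈↓-⊗⁺ (k ∷ X) Y (inj₁ g≼k) h∈Y =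
    ∈↓-++⁺ˡ (map (k ++_) Y) (∈↓-≼ (map (k ++_) Y) (≼-++ k g≼k (≼-refl _)) (prefix h∈Y))
    where
    prefix : ∀ {Y h} → h ∈↓ Y → k ++ h ∈↓ map (k ++_) Y
    prefix {l ∷ Y} (inj₁ h≼l) = inj₁ (≼-++ k (≼-refl k) h≼l)
    prefix {l ∷ Y} (inj₂ h∈Y) = inj₂ (prefix h∈Y)
  ∈↓-⊗⁺ (k ∷ X) Y (inj₂ g∈X) h∈Y = ∈↓-++⁺ʳ (map (k ++_) Y) (∈↓-⊗⁺ X Y g∈X h∈Y)

  ∈↓-⊗⁻ : ∀ X Y {w} → w ∈↓ X ⊗ Y → ∃₂ λ g h → g ∈↓ X × h ∈↓ Y × w ≼ g ++ h
  ∈↓-⊗⁻ (g ∷ X) Y w∈XY with ∈↓-++⁻ (map (g ++_) Y) w∈XY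
  ... | inj₁ w∈gY =
    let h , h∈Y , w≼gh = unprefix Y w∈gY in g , h , inj₁ (≼-refl g) , h∈Y , w≼gh
    where
    unprefix : ∀ Y {w} → w ∈↓ map (g ++_) Y → ∃ λ h → h ∈↓ Y × w ≼ g ++ h
    unprefix (h ∷ Y) (inj₁ w≼gh) = h , inj₁ (≼-refl h) , w≼gh
    unprefix (h ∷ Y) (inj₂ w∈gY) =
      let k , k∈Y , w≼gk = unprefix Y w∈gY in k , inj₂ k∈Y , w≼gk
  ... | inj₂ w∈XY' = let g' , h , g'∈X , h∈Y , w≼g'h = ∈↓-⊗⁻ X Y w∈XY' in
                     g' , h , inj₂ g'∈X , h∈Y , w≼g'h

  ++-mono-⊆↓ : ∀ X {X' Y Y'} → X ⊆↓ X' → Y ⊆↓ Y' → X ++ Y ⊆↓ X' ++ Y'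
  ++-mono-⊆↓ X {X'} X⊆X' Y⊆Y' w∈XY with ∈↓-++⁻ X w∈XY
  ... | inj₁ w∈X = ∈↓-++⁺ˡ X' (X⊆X' w∈X)
  ... | inj₂ w∈Y = ∈↓-++⁺ʳ X' (Y⊆Y' w∈Y)

  ++-least-⊆↓ : ∀ X {Y Z} → X ⊆↓ Z → Y ⊆↓ Z → X ++ Y ⊆↓ Z
  ++-least-⊆↓ X X⊆Z Y⊆Z w∈XY with ∈↓-++⁻ X w∈XY
  ... | inj₁ w∈X = X⊆Z w∈X
  ... | inj₂ w∈Y = Y⊆Z w∈Y

  ⊗-mono-⊆↓ : ∀ X {X'} Y {Y'} → X ⊆↓ X' → Y ⊆↓ Y' → X ⊗ Y ⊆↓ X' ⊗ Y'
  ⊗-mono-⊆↓ X {X'} Y {Y'} X⊆X' Y⊆Y' w∈XY =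
    let g , h , g∈X , h∈Y , w≼gh = ∈↓-⊗⁻ X Y w∈XY
    in ∈↓-≼ (X' ⊗ Y') w≼gh (∈↓-⊗⁺ X' Y' (X⊆X' g∈X) (Y⊆Y' h∈Y))

  ⊗-assocʳ-⊆↓ : ∀ X Y Z → (X ⊗ Y) ⊗ Z ⊆↓ X ⊗ (Y ⊗ Z)
  ⊗-assocʳ-⊆↓ X Y Z w∈XYZ =
    let gh , k , gh∈XY , k∈Z , w≼ghk = ∈↓-⊗⁻ (X ⊗ Y) Z w∈XYZ
        g , h , g∈X , h∈Y , gh≼g++h = ∈↓-⊗⁻ X Y gh∈XY
    in ∈↓-≼ (X ⊗ (Y ⊗ Z)) (≼-trans _ _ w≼ghk (≼-++ (g ++ h) gh≼g++h (≼-refl k)))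
         (subst (_∈↓ X ⊗ (Y ⊗ Z)) (sym (++-assoc g h k))
           (∈↓-⊗⁺ X (Y ⊗ Z) g∈X (∈↓-⊗⁺ Y Z h∈Y k∈Z)))

  ⊗-assocˡ-⊆↓ : ∀ X Y Z → X ⊗ (Y ⊗ Z) ⊆↓ (X ⊗ Y) ⊗ Z
  ⊗-assocˡ-⊆↓ X Y Z w∈XYZ =
    let g , hk , g∈X , hk∈YZ , w≼ghk = ∈↓-⊗⁻ X (Y ⊗ Z) w∈XYZ
        h , k , h∈Y , k∈Z , hk≼h++k = ∈↓-⊗⁻ Y Z hk∈YZ
    in ∈↓-≼ ((X ⊗ Y) ⊗ Z) (≼-trans _ _ w≼ghk (≼-++ g (≼-refl g) hk≼h++k))
         (subst (_∈↓ (X ⊗ Y) ⊗ Z) (++-assoc g h k)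
           (∈↓-⊗⁺ (X ⊗ Y) Z (∈↓-⊗⁺ X Y g∈X h∈Y) k∈Z))

  ⊗-identityˡ-⊆↓ : ∀ X → [ [] ] ⊗ X ⊆↓ X
  ⊗-identityˡ-⊆↓ X w∈X' =
    let g , h , _ , h∈X , w≼gh = ∈↓-⊗⁻ [ [] ] X w∈X'
    in ∈↓-≼ X (≼-trans _ _ w≼gh (≼-++ˡ g h (≼-refl h))) h∈X

  ⊗-identityʳ-⊆↓ : ∀ X → X ⊗ [ [] ] ⊆↓ X
  ⊗-identityʳ-⊆↓ X w∈X' =
    let g , h , g∈X , _ , w≼gh = ∈↓-⊗⁻ X [ [] ] w∈X'
    in ∈↓-≼ X (≼-trans _ _ w≼gh (≼-++ʳ h g (≼-refl g))) g∈X

  ⊗-distribˡ-++-⊆↓ : ∀ X Y Z → X ⊗ (Y ++ Z) ⊆↓ X ⊗ Y ++ X ⊗ Z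
  ⊗-distribˡ-++-⊆↓ X Y Z w∈XYZ with ∈↓-⊗⁻ X (Y ++ Z) w∈XYZ
  ... | g , h , g∈X , h∈YZ , w≼gh = ∈↓-≼ (X ⊗ Y ++ X ⊗ Z) w≼gh (gh∈ (∈↓-++⁻ Y h∈YZ))
    where
    gh∈ : h ∈↓ Y ⊎ h ∈↓ Z → g ++ h ∈↓ X ⊗ Y ++ X ⊗ Z
    gh∈ (inj₁ h∈Y) = ∈↓-++⁺ˡ (X ⊗ Y) (∈↓-⊗⁺ X Y g∈X h∈Y)
    gh∈ (inj₂ h∈Z) = ∈↓-++⁺ʳ (X ⊗ Y) (∈↓-⊗⁺ X Z g∈X h∈Z)

  -- Down-sets are generated by nonempty lists, since the empty down-set would be
  -- an absorbing zero and spoil cancellativity; ⟨ A ⊙ B ⟩ reduces to ⟨ A ⟩ ⊗ ⟨ B ⟩.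
  infixl 7 _⊙_
  _⊙_ : List⁺ Word → List⁺ Word → List⁺ Word
  (g ∷ X) ⊙ (h ∷ Y) = (g ++ h) ∷ (map (g ++_) Y ++ X ⊗ (h ∷ Y))

  ⟨_⟩ : List⁺ Word → List Word
  ⟨_⟩ = toList

  _≈ᴹ_ : List⁺ Word → List⁺ Word → Set ℓ
  A ≈ᴹ B = ⟨ A ⟩ ⊑ ⟨ B ⟩ × ⟨ B ⟩ ⊑ ⟨ A ⟩

  ≈ᴹ-intro : ∀ {A B} → ⟨ A ⟩ ⊆↓ ⟨ B ⟩ → ⟨ B ⟩ ⊆↓ ⟨ A ⟩ → A ≈ᴹ B
  ≈ᴹ-intro {A} {B} A⊆B B⊆A = ⊆↓⇒⊑ ⟨ A ⟩ A⊆B , ⊆↓⇒⊑ ⟨ B ⟩ B⊆A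

  ≈ᴹ⇒⊆↓ : ∀ {A B} → A ≈ᴹ B → ⟨ A ⟩ ⊆↓ ⟨ B ⟩
  ≈ᴹ⇒⊆↓ {A} (A⊑B , _) = ⊑⇒⊆↓ ⟨ A ⟩ A⊑B

  ≈ᴹ⇒⊇↓ : ∀ {A B} → A ≈ᴹ B → ⟨ B ⟩ ⊆↓ ⟨ A ⟩
  ≈ᴹ⇒⊇↓ {B = B} (_ , B⊑A) = ⊑⇒⊆↓ ⟨ B ⟩ B⊑A

  ≡⇒≈ᴹ : ∀ {A B} → ⟨ A ⟩ ≡ ⟨ B ⟩ → A ≈ᴹ B
  ≡⇒≈ᴹ A≡B = ≈ᴹ-intro (λ {w} → subst (w ∈↓_) A≡B) (λ {w} → subst (w ∈↓_) (sym A≡B))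

  ≈ᴹ-isEquivalence : IsEquivalence _≈ᴹ_
  ≈ᴹ-isEquivalence = record
    { refl  = λ {A} → ≈ᴹ-intro {A} id id
    ; sym   = λ (A⊑B , B⊑A) → B⊑A , A⊑B
    ; trans = λ A≈B B≈C → ≈ᴹ-intro (λ w∈A → ≈ᴹ⇒⊆↓ B≈C (≈ᴹ⇒⊆↓ A≈B w∈A))
                                   (λ w∈C → ≈ᴹ⇒⊇↓ A≈B (≈ᴹ⇒⊇↓ B≈C w∈C))
    }

  M : SLMonoid c ℓ
  M = record
    { raw = record
      { Carrier = List⁺ Word ; _≈_ = _≈ᴹ_ ; _∨_ = _⁺++⁺_ ; _·_ = _⊙_ ; one = [] ∷ [] }
    ; isSLMonoid = record
      { isEquivalence = ≈ᴹ-isEquivalence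
      ; ∨-cong = λ {A} {A'} A≈A' B≈B' → ≈ᴹ-intro
          (++-mono-⊆↓ ⟨ A ⟩  (≈ᴹ⇒⊆↓ A≈A') (≈ᴹ⇒⊆↓ B≈B'))
          (++-mono-⊆↓ ⟨ A' ⟩ (≈ᴹ⇒⊇↓ A≈A') (≈ᴹ⇒⊇↓ B≈B'))
      ; ·-cong = λ {A} {A'} {B} {B'} A≈A' B≈B' → ≈ᴹ-intro
          (⊗-mono-⊆↓ ⟨ A ⟩  ⟨ B ⟩  (≈ᴹ⇒⊆↓ A≈A') (≈ᴹ⇒⊆↓ B≈B'))
          (⊗-mono-⊆↓ ⟨ A' ⟩ ⟨ B' ⟩ (≈ᴹ⇒⊇↓ A≈A') (≈ᴹ⇒⊇↓ B≈B'))
      ; ∨-assoc = λ A B C → ≡⇒≈ᴹ (++-assoc ⟨ A ⟩ ⟨ B ⟩ ⟨ C ⟩)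
      ; ∨-comm = λ A B → ≈ᴹ-intro
          (++-least-⊆↓ ⟨ A ⟩ (∈↓-++⁺ʳ ⟨ B ⟩) (∈↓-++⁺ˡ ⟨ B ⟩))
          (++-least-⊆↓ ⟨ B ⟩ (∈↓-++⁺ʳ ⟨ A ⟩) (∈↓-++⁺ˡ ⟨ A ⟩))
      ; ∨-idem = λ A → ≈ᴹ-intro (++-least-⊆↓ ⟨ A ⟩ id id) (∈↓-++⁺ˡ ⟨ A ⟩)
      ; ·-assoc = λ A B C → ≈ᴹ-intro
          (⊗-assocʳ-⊆↓ ⟨ A ⟩ ⟨ B ⟩ ⟨ C ⟩)
          (⊗-assocˡ-⊆↓ ⟨ A ⟩ ⟨ B ⟩ ⟨ C ⟩)
      ; ·-identityˡ = λ A → ≈ᴹ-intro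
          (⊗-identityˡ-⊆↓ ⟨ A ⟩)
          (∈↓-⊗⁺ [ [] ] ⟨ A ⟩ (inj₁ tt))
      ; ·-identityʳ = λ A → ≈ᴹ-intro
          (⊗-identityʳ-⊆↓ ⟨ A ⟩)
          (λ {w} w∈A → subst (_∈↓ ⟨ A ⟩ ⊗ [ [] ]) (++-identityʳ w)
                             (∈↓-⊗⁺ ⟨ A ⟩ [ [] ] w∈A (inj₁ tt)))
      ; ·-distribˡ-∨ = λ A B C → ≈ᴹ-intro
          (⊗-distribˡ-++-⊆↓ ⟨ A ⟩ ⟨ B ⟩ ⟨ C ⟩)
          (++-least-⊆↓ (⟨ A ⟩ ⊗ ⟨ B ⟩)
            (⊗-mono-⊆↓ ⟨ A ⟩ ⟨ B ⟩ id (∈↓-++⁺ˡ ⟨ B ⟩))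
            (⊗-mono-⊆↓ ⟨ A ⟩ ⟨ C ⟩ id (∈↓-++⁺ʳ ⟨ B ⟩)))
      ; ·-distribʳ-∨ = λ A B C →
          ≡⇒≈ᴹ (cartesianProductWith-distribʳ-++ _++_ ⟨ B ⟩ ⟨ C ⟩ ⟨ A ⟩)
      } }

  open SLMonoid M using () renaming (_≤_ to _≤ᴹ_)
  private module Mᴼ = SLMonoidOrder M

  ≤ᴹ⇒⊆↓ : ∀ {A B} → A ≤ᴹ B → ⟨ A ⟩ ⊆↓ ⟨ B ⟩
  ≤ᴹ⇒⊆↓ {A} {B} (AB⊑B , _) w∈A = ⊑⇒⊆↓ (⟨ A ⟩ ++ ⟨ B ⟩) AB⊑B (∈↓-++⁺ˡ ⟨ A ⟩ w∈A)

  ⊆↓⇒≤ᴹ : ∀ {A B} → ⟨ A ⟩ ⊆↓ ⟨ B ⟩ → A ≤ᴹ B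
  ⊆↓⇒≤ᴹ {A} A⊆B = ≈ᴹ-intro (++-least-⊆↓ ⟨ A ⟩ A⊆B id) (∈↓-++⁺ʳ ⟨ A ⟩)

  M-integral : IsIntegral M
  M-integral _ = ⊆↓⇒≤ᴹ (λ _ → inj₁ tt)

  cancelʳ : ∀ {x} Y Z → (∀ {w} → w ∈↓ Z → x ++ w ∈↓ Y ⊗ Z) →
            ∀ {w} → Acc _<_ (length w) → w ∈↓ Z → x ∈↓ Y
  cancelʳ {x} Y Z xZ⊆YZ {w} (acc shorter) w∈Z with ∈↓-⊗⁻ Y Z (xZ⊆YZ w∈Z)
  ... | y , z , y∈Y , z∈Z , xw≼yz with ≼-split y z xw≼yz
  ... | j , p₁ , p₂ with take-++-or-drop-shorter j x w
  ... | inj₁ e     = ∈↓-≼ Y (≼-take j y (subst (_≼ y) e p₁)) y∈Y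
  ... | inj₂ short = cancelʳ Y Z xZ⊆YZ (shorter short) (∈↓-≼ Z p₂ z∈Z)

  cancelˡ : ∀ {x} Y Z → (∀ {w} → w ∈↓ Z → w ++ x ∈↓ Z ⊗ Y) →
            ∀ {w} → Acc _<_ (length w) → w ∈↓ Z → x ∈↓ Y
  cancelˡ {x} Y Z Zx⊆ZY {w} (acc shorter) w∈Z with ∈↓-⊗⁻ Z Y (Zx⊆ZY w∈Z)
  ... | z , y , z∈Z , y∈Y , wx≼zy with ≼-split z y wx≼zy
  ... | j , p₁ , p₂ with drop-++-or-take-shorter j w x
  ... | inj₁ (k , e) = ∈↓-≼ Y (≼-drop k y (subst (_≼ y) e p₂)) y∈Y
  ... | inj₂ short   = cancelˡ Y Z Zx⊆ZY (shorter short) (∈↓-≼ Z p₁ z∈Z)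

  head∈↓ : ∀ A → List⁺.head A ∈↓ ⟨ A ⟩
  head∈↓ A = inj₁ (≼-refl (List⁺.head A))

  M-cancellative : IsCancellative M
  M-cancellative = cancelʳᴹ , cancelˡᴹ
    where
    cancelʳᴹ : ∀ A B C → A ⊙ C ≤ᴹ B ⊙ C → A ≤ᴹ B
    cancelʳᴹ A B C AC≤BC = ⊆↓⇒≤ᴹ λ x∈A →
      cancelʳ ⟨ B ⟩ ⟨ C ⟩ (λ w∈C → ≤ᴹ⇒⊆↓ AC≤BC (∈↓-⊗⁺ ⟨ A ⟩ ⟨ C ⟩ x∈A w∈C))
              (<-wellFounded _) (head∈↓ C)

    cancelˡᴹ : ∀ A B C → C ⊙ A ≤ᴹ C ⊙ B → A ≤ᴹ B
    cancelˡᴹ A B C CA≤CB = ⊆↓⇒≤ᴹ λ x∈A →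
      cancelˡ ⟨ B ⟩ ⟨ C ⟩ (λ w∈C → ≤ᴹ⇒⊆↓ CA≤CB (∈↓-⊗⁺ ⟨ C ⟩ ⟨ A ⟩ w∈C x∈A))
              (<-wellFounded _) (head∈↓ C)

  ⋁ev : Word → List Word → Carrier
  ⋁ev g []      = ev g
  ⋁ev g (h ∷ X) = ev g ∨ ⋁ev h X

  ⋁ev-upper : ∀ g X {w} → w ∈↓ g ∷ X → ev w ≤ ⋁ev g X
  ⋁ev-upper g []      (inj₁ w≼g) = ≼⇒ev≤ g w≼g
  ⋁ev-upper g (h ∷ X) (inj₁ w≼g) = ≤-trans (≼⇒ev≤ g w≼g) (x≤x∨y _ _)
  ⋁ev-upper g (h ∷ X) (inj₂ w∈X) = ≤-trans (⋁ev-upper h X w∈X) (y≤x∨y _ _)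

  ⋁ev-least : ∀ {f : Carrier → Carrier} → (∀ a b → f (a ∨ b) ≈ f a ∨ f b) →
              ∀ g X {a} → (∀ {w} → w ∈↓ g ∷ X → f (ev w) ≤ a) → f (⋁ev g X) ≤ a
  ⋁ev-least f-∨ g []      f≤a = f≤a (inj₁ (≼-refl g))
  ⋁ev-least f-∨ g (h ∷ X) f≤a =
    ≤-trans (≤-reflexive (f-∨ _ _))
            (∨-least (f≤a (inj₁ (≼-refl g))) (⋁ev-least f-∨ h X (λ w∈X → f≤a (inj₂ w∈X))))

  ⟦_⟧ : List⁺ Word → Carrier
  ⟦ g ∷ X ⟧ = ⋁ev g X

  ⟦⟧-upper : ∀ A {w} → w ∈↓ ⟨ A ⟩ → ev w ≤ ⟦ A ⟧
  ⟦⟧-upper (g ∷ X) = ⋁ev-upper g X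

  ⟦⟧-mono : ∀ A B → ⟨ A ⟩ ⊆↓ ⟨ B ⟩ → ⟦ A ⟧ ≤ ⟦ B ⟧
  ⟦⟧-mono (g ∷ X) B A⊆B =
    ⋁ev-least {f = id} (λ _ _ → ≈-refl) g X (λ w∈A → ⟦⟧-upper B (A⊆B w∈A))

  ⟦⟧-⊙ : ∀ A B → ⟦ A ⟧ · ⟦ B ⟧ ≤ ⟦ A ⊙ B ⟧
  ⟦⟧-⊙ (g ∷ X) (h ∷ Y) =
    ⋁ev-least (·-distribʳ-∨ (⋁ev h Y)) g X λ {u} u∈A →
    ⋁ev-least (·-distribˡ-∨ (ev u)) h Y λ {v} v∈B →
    ≤-trans (≤-reflexive (≈-sym (ev-++ u v)))
            (⟦⟧-upper ((g ∷ X) ⊙ (h ∷ Y)) (∈↓-⊗⁺ (g ∷ X) (h ∷ Y) u∈A v∈B))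

  η : Carrier → List⁺ Word
  η a = [ a ] ∷ []

  ⟦η⟧ : ∀ a → ⟦ η a ⟧ ≈ a
  ⟦η⟧ = ·-identityʳ

  η-⊑ : ∀ {a b} → a ≤ b → ⟨ η a ⟩ ⊑ ⟨ η b ⟩
  η-⊑ {a} a≤b = inj₁ (≼-singleton⁺ (≤-trans (≤-reflexive (⟦η⟧ a)) a≤b)) , tt

  η-⊑⁻ : ∀ {a b} → ⟨ η a ⟩ ⊑ ⟨ η b ⟩ → a ≤ b
  η-⊑⁻ {a} (inj₁ a≼b , _) = ≤-trans (≤-reflexive (≈-sym (⟦η⟧ a))) (≼-singleton⁻ a≼b)

  η-mono : ∀ {a b} → a ≤ b → η a ≤ᴹ η b
  η-mono a≤b = ⊆↓⇒≤ᴹ (⊑⇒⊆↓ _ (η-⊑ a≤b))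

  η-cong : ∀ {a b} → a ≈ b → η a ≈ᴹ η b
  η-cong a≈b = η-⊑ (≤-reflexive a≈b) , η-⊑ (≤-reflexive (≈-sym a≈b))

  η-injective : ∀ {a b} → η a ≈ᴹ η b → a ≈ b
  η-injective (a⊑b , b⊑a) = ≤-antisym (η-⊑⁻ a⊑b) (η-⊑⁻ b⊑a)

  γ : List⁺ Word → List⁺ Word
  γ A = η ⟦ A ⟧

  γ-extensive : ∀ A → A ≤ᴹ γ A
  γ-extensive A = ⊆↓⇒≤ᴹ (λ w∈A → inj₁ (≼-singleton⁺ (⟦⟧-upper A w∈A)))

  ⟦η⊙η⟧ : ∀ a b → ⟦ η a ⊙ η b ⟧ ≈ a · b
  ⟦η⊙η⟧ a b = ·-cong ≈-refl (·-identityʳ b)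

  nucleus : IsNucleus M γ
  nucleus = record
    { monotone = λ {A} {B} A≤B → η-mono (⟦⟧-mono A B (≤ᴹ⇒⊆↓ A≤B))
    ; extensive = γ-extensive
    ; idempotent = λ A → η-cong (⟦η⟧ ⟦ A ⟧)
    ; submultiplicative = λ A B → begin
        γ A ⊙ γ B           ≤⟨ γ-extensive (γ A ⊙ γ B) ⟩
        γ (γ A ⊙ γ B)       ≈⟨ η-cong (⟦η⊙η⟧ ⟦ A ⟧ ⟦ B ⟧) ⟩
        η (⟦ A ⟧ · ⟦ B ⟧)   ≤⟨ η-mono (⟦⟧-⊙ A B) ⟩
        γ (A ⊙ B)           ∎
    }
    where open PosetReasoning Mᴼ.poset

  η-fixed : Carrier → Σ (List⁺ Word) λ A → γ A ≈ᴹ A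
  η-fixed a = η a , η-cong (⟦η⟧ a)

  η-isomorphism : IsIsomorphism (SLMonoid.raw N) (nuclearImage M γ nucleus) η-fixed
  η-isomorphism = record
    { cong       = η-cong
    ; injective  = η-injective
    ; surjective = λ (A , γA≈A) → ⟦ A ⟧ , γA≈A
    ; ∨-homo     = λ a b → η-cong (≈-sym (∨-cong (⟦η⟧ a) (⟦η⟧ b)))
    ; ·-homo     = λ a b → η-cong (≈-sym (⟦η⊙η⟧ a b))
    ; one-homo   = η-cong ≈-refl
    }

theoremD : ∀ {c ℓ} (N : SLMonoid c ℓ) →
    IsIntegral N ⇔
      Σ (SLMonoid c ℓ) (λ M → IsIntegral M × IsCancellative M ×
        Σ (SLMonoid.Carrier M → SLMonoid.Carrier M) (λ γ →
          Σ (IsNucleus M γ) (λ nuc →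
            SLMonoid.raw N ≅ nuclearImage M γ nuc)))
theoremD N = mk⇔
  (λ integral → let open CoverMonoid N integral in
    M , M-integral , M-cancellative , γ , nucleus , η-fixed , η-isomorphism)
  (λ (M , M-integral , _ , _ , nucleus , N≅Mγ) →
    NuclearImage.integral-if-≅-nuclearImage M nucleus N M-integral N≅Mγ)
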